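{- Let $m\ge1$, let $d_1,\dots,d_m$ be positive integers, let $p$ be a positive integer, and write $p\cdot{\bf d}^m=(pd_1,\dots,pd_m)$ and $\xi=\frac12\sum_{i=1}^m d_i$. Then for all integers $s$, $$\widetilde W(s,p\cdot{\bf d}^m)=\Psi_p(s)\,\widetilde W\!\left(\tfrac{s}{p},{\bf d}^m\right),$$ (where the right side is read as $0$ when $p\nmid s$), or equivalently, for all $s\in p\xi+\mathbb{Z}$, $$V(s,p\cdot{\bf d}^m)=\Psi_p(s-p\xi)\,V\!\left(\tfrac{s}{p},{\bf d}^m\right).$$
   Context: For positive integers $e_1,\dots,e_n$ and an integer $s\ge0$, $W(s,{\bf e})$ is the coefficient of $t^s$ in $\prod_{r=1}^n(1-t^{e_r})^{ -1}$; $\widetilde W(\cdot,{\bf e}):\mathbb Z\to\mathbb Q$ is the unique function of the form $\sum_{i=0}^{n-1}c_i(s)s^i$ with periodic $c_i$ agreeing with $W(s,{\bf e})$ for all $s\ge0$. With $\xi({\bf e})=\frac12\sum e_r$, $V(s,{\bf e})=\widetilde W(s-\xi({\bf e}),{\bf e})$ for $s\in\xi({\bf e})+\mathbb Z$. For a positive integer $p$, $\Psi_p(s)=1$ if $s\equiv0\pmod p$ and $\Psi_p(s)=0$ otherwise. -}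

module Defs where

open import Data.Nat as ℕ using (ℕ; zero; suc; NonZero)
open import Data.Nat.Divisibility using (_∣?_)
open import Data.Integer as ℤ using (ℤ)
open import Data.Rational as ℚ using (ℚ)
open import Data.Fin using (Fin)
open import Data.Vec using (Vec; []; _∷_; map; lookup)
open import Data.Product using (Σ; _×_)
open import Relation.Nullary using (does)
open import Data.Bool using (if_then_else_)
open import Relation.Binary.PropositionalEquality using (_≡_)

-- Coefficient of t^j in (1 - t^e)^{-1}, i.e. 1 if e ∣ j and 0 otherwise (e > 0).
geomCoeff : ℕ → ℕ → ℕ
geomCoeff e j = if does (e ∣? j) then 1 else 0

-- W s e = coefficient of t^s in ∏_r (1 - t^{e_r})^{-1}, computed as the
-- Cauchy product of power series: the empty product is 1, and
-- [t^s] (1-t^e)^{-1} · F(t) = Σ_{j=0}^{s} [t^j](1-t^e)^{-1} · [t^{s-j}] F(t).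
convSum : (ℕ → ℕ) → (ℕ → ℕ) → ℕ → ℕ
convSum a b zero    = a 0 ℕ.* b 0
convSum a b (suc s) = convSum a (λ k → b (suc k)) s ℕ.+ a (suc s) ℕ.* b 0
-- convSum a b s = Σ_{j=0}^{s} a j * b (s - j)   (checked by recursion on s)

W : ∀ {n} → ℕ → Vec ℕ n → ℕ
W zero    []       = 1
W (suc s) []       = 0
W s       (e ∷ es) = convSum (geomCoeff e) (λ k → W k es) s

pow : ℚ → ℕ → ℚ
pow x zero    = ℚ.1ℚ
pow x (suc i) = x ℚ.* pow x i

sumFin : ∀ n → (Fin n → ℚ) → ℚ
sumFin zero    f = ℚ.0ℚ
sumFin (suc n) f = f Fin.zero ℚ.+ sumFin n (λ i → f (Fin.suc i))
  where import Data.Fin as Fin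

Periodic : (ℤ → ℚ) → Set
Periodic c = Σ ℕ λ N → NonZero N × (∀ s → c (s ℤ.+ ℤ.+ N) ≡ c s)

IsQuasiPoly : ℕ → (ℤ → ℚ) → Set
IsQuasiPoly n f = Σ (Fin n → ℤ → ℚ) λ c →
  (∀ i → Periodic (c i)) × (∀ s → f s ≡ sumFin n (λ i → c i s ℚ.* pow (s ℚ./ 1) (Data.Fin.toℕ i)))
  where import Data.Fin

-- f is "W-tilde(·, e)": a quasi-polynomial of degree < n agreeing with
-- W(s, e) for all s ≥ 0.  (Such f is unique.)
IsWtilde : ∀ {n} → Vec ℕ n → (ℤ → ℚ) → Set
IsWtilde {n} e f = IsQuasiPoly n f × (∀ (s : ℕ) → f (ℤ.+ s) ≡ (ℤ.+ W s e) ℚ./ 1)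

scale : ∀ {n} → ℕ → Vec ℕ n → Vec ℕ n
scale p d = map (p ℕ.*_) d

-- On each residue class modulo a common period, both W̃(·, p·d) and W̃(·, d) are
-- polynomials of degree < m, i.e. have vanishing m-th finite difference. Such a
-- quasi-polynomial is determined by its values on ℕ: along the progression through any s
-- it vanishes from some point on, and a polynomial that vanishes on a half-line vanishes.
-- On ℕ the claim is a statement about W itself, and there it holds because
-- ∏ (1 - t^(p dᵣ))⁻¹ is ∏ (1 - t^dᵣ)⁻¹ evaluated at t^p.

module Submission where

open import Defs
open import Data.Nat using (ℕ; NonZero; _≥_)
open import Data.Integer using (ℤ; +_; _*_)
open import Data.Integer.Divisibility using (_∣_)
open import Data.Rational using (ℚ; 0ℚ)
open import Data.Fin using (Fin)
open import Data.Vec using (Vec; lookup)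
open import Data.Product using (_×_)
open import Relation.Nullary using (¬_)
open import Relation.Binary.PropositionalEquality using (_≡_)

open import Data.Nat as ℕ using (zero; suc; _≤_; _<_; z≤n; s≤s)
import Data.Nat.Properties as ℕP
import Data.Nat.Divisibility as ℕD
open import Data.Integer as ℤ using (-[1+_]; ∣_∣)
import Data.Integer.Properties as ℤP
import Data.Integer.DivMod as ℤD
import Data.Integer.Solver
import Data.Rational as ℚ
import Data.Rational.Properties as ℚP
import Data.Rational.Solver
import Data.Rational.Unnormalised as ℚᵘ
import Data.Rational.Unnormalised.Properties as ℚᵘP
import Data.Nat.Coprimality as Coprime
open import Data.Fin as Fin using (toℕ)
import Data.Fin.Properties as FinP
open import Data.Vec using ([]; _∷_)
open import Data.Product using (∃; ∃₂; _,_; proj₁; proj₂)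
open import Relation.Nullary using (yes; no)
open import Relation.Nullary.Negation using (contradiction)
open import Relation.Binary.PropositionalEquality using (refl; sym; trans; cong; cong₂; subst; module ≡-Reasoning)

module ℤS = Data.Integer.Solver.+-*-Solver
module ℚS = Data.Rational.Solver.+-*-Solver

Δ[_] : ℕ → (ℤ → ℚ) → ℤ → ℚ
Δ[ Q ] h x = h (x ℤ.+ + Q) ℚ.- h x

Δ : (ℤ → ℚ) → ℤ → ℚ
Δ = Δ[ 1 ]

data DegreeBelow : ℕ → (ℤ → ℚ) → Set where
  identically-zero : ∀ {h} → (∀ k → h k ≡ 0ℚ) → DegreeBelow zero h
  Δ-degreeBelow    : ∀ {n h} → DegreeBelow n (Δ h) → DegreeBelow (suc n) h

x-y≡0⇒x≡y : ∀ {x y} → x ℚ.- y ≡ 0ℚ → x ≡ y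
x-y≡0⇒x≡y {x} {y} x-y≡0 = begin
  x                 ≡⟨ ℚS.solve 2 (λ x y → x ℚS.:= (x ℚS.:- y) ℚS.:+ y) refl x y ⟩
  (x ℚ.- y) ℚ.+ y   ≡⟨ cong (ℚ._+ y) x-y≡0 ⟩
  0ℚ ℚ.+ y          ≡⟨ ℚP.+-identityˡ y ⟩
  y                 ∎
  where open ≡-Reasoning

x≡y⇒x-y≡0 : ∀ {x y} → x ≡ y → x ℚ.- y ≡ 0ℚ
x≡y⇒x-y≡0 {x} refl = ℚP.+-inverseʳ x

DegreeBelow-cong : ∀ {n h h′} → (∀ k → h k ≡ h′ k) → DegreeBelow n h → DegreeBelow n h′
DegreeBelow-cong h≗h′ (identically-zero h≡0) = identically-zero (λ k → trans (sym (h≗h′ k)) (h≡0 k))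
DegreeBelow-cong h≗h′ (Δ-degreeBelow d) =
  Δ-degreeBelow (DegreeBelow-cong (λ k → cong₂ ℚ._-_ (h≗h′ _) (h≗h′ k)) d)

DegreeBelow-0 : ∀ n → DegreeBelow n (λ _ → 0ℚ)
DegreeBelow-0 zero    = identically-zero (λ _ → refl)
DegreeBelow-0 (suc n) = Δ-degreeBelow (DegreeBelow-cong (λ _ → refl) (DegreeBelow-0 n))

DegreeBelow-≤ : ∀ {m n h} → m ≤ n → DegreeBelow m h → DegreeBelow n h
DegreeBelow-≤ {n = n} z≤n (identically-zero h≡0) = DegreeBelow-cong (λ k → sym (h≡0 k)) (DegreeBelow-0 n)
DegreeBelow-≤ (s≤s m≤n) (Δ-degreeBelow d) = Δ-degreeBelow (DegreeBelow-≤ m≤n d)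

DegreeBelow-+ : ∀ {n h h′} → DegreeBelow n h → DegreeBelow n h′ → DegreeBelow n (λ k → h k ℚ.+ h′ k)
DegreeBelow-+ (identically-zero h≡0) (identically-zero h′≡0) =
  identically-zero (λ k → cong₂ ℚ._+_ (h≡0 k) (h′≡0 k))
DegreeBelow-+ {h = h} {h′} (Δ-degreeBelow d) (Δ-degreeBelow d′) =
  Δ-degreeBelow (DegreeBelow-cong (λ k → Δ-+ (h _) (h k) (h′ _) (h′ k)) (DegreeBelow-+ d d′))
  where
  open ℚS
  Δ-+ : ∀ a b c d → (a ℚ.- b) ℚ.+ (c ℚ.- d) ≡ (a ℚ.+ c) ℚ.- (b ℚ.+ d)
  Δ-+ = solve 4 (λ a b c d → (a :- b) :+ (c :- d) := (a :+ c) :- (b :+ d)) refl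

DegreeBelow-sub : ∀ {n h h′} → DegreeBelow n h → DegreeBelow n h′ → DegreeBelow n (λ k → h k ℚ.- h′ k)
DegreeBelow-sub (identically-zero h≡0) (identically-zero h′≡0) =
  identically-zero (λ k → cong₂ ℚ._-_ (h≡0 k) (h′≡0 k))
DegreeBelow-sub {h = h} {h′} (Δ-degreeBelow d) (Δ-degreeBelow d′) =
  Δ-degreeBelow (DegreeBelow-cong (λ k → Δ-sub (h _) (h k) (h′ _) (h′ k)) (DegreeBelow-sub d d′))
  where
  open ℚS
  Δ-sub : ∀ a b c d → (a ℚ.- b) ℚ.- (c ℚ.- d) ≡ (a ℚ.- c) ℚ.- (b ℚ.- d)
  Δ-sub = solve 4 (λ a b c d → (a :- b) :- (c :- d) := (a :- c) :- (b :- d)) refl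

DegreeBelow-scale : ∀ {n h} c → DegreeBelow n h → DegreeBelow n (λ k → c ℚ.* h k)
DegreeBelow-scale c (identically-zero h≡0) =
  identically-zero (λ k → trans (cong (c ℚ.*_) (h≡0 k)) (ℚP.*-zeroʳ c))
DegreeBelow-scale {h = h} c (Δ-degreeBelow d) =
  Δ-degreeBelow (DegreeBelow-cong (λ k → Δ-scale (h _) (h k)) (DegreeBelow-scale c d))
  where
  open ℚS
  Δ-scale : ∀ a b → c ℚ.* (a ℚ.- b) ≡ c ℚ.* a ℚ.- c ℚ.* b
  Δ-scale = solve 3 (λ c a b → c :* (a :- b) := c :* a :- c :* b) refl c

DegreeBelow-shift : ∀ {n h} c → DegreeBelow n h → DegreeBelow n (λ x → h (x ℤ.+ c))
DegreeBelow-shift c (identically-zero h≡0) = identically-zero (λ x → h≡0 (x ℤ.+ c))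
DegreeBelow-shift {h = h} c (Δ-degreeBelow d) =
  Δ-degreeBelow (DegreeBelow-cong (λ x → cong (λ y → h y ℚ.- h (x ℤ.+ c)) (swap x)) (DegreeBelow-shift c d))
  where
  swap : ∀ x → (x ℤ.+ c) ℤ.+ ℤ.1ℤ ≡ (x ℤ.+ ℤ.1ℤ) ℤ.+ c
  swap x = ℤS.solve 2 (λ x c → (x ℤS.:+ c) ℤS.:+ ℤS.con ℤ.1ℤ ℤS.:= (x ℤS.:+ ℤS.con ℤ.1ℤ) ℤS.:+ c) refl x c

DegreeBelow-Δ[] : ∀ {n h} Q → DegreeBelow (suc n) h → DegreeBelow n (Δ[ Q ] h)
DegreeBelow-Δ[] {n} {h} zero _ =
  DegreeBelow-cong (λ x → sym (x≡y⇒x-y≡0 (cong h (ℤP.+-identityʳ x)))) (DegreeBelow-0 n)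
DegreeBelow-Δ[] {h = h} (suc Q) d@(Δ-degreeBelow Δd) =
  DegreeBelow-cong (λ x → sym (telescope x)) (DegreeBelow-+ Δd (DegreeBelow-shift ℤ.1ℤ (DegreeBelow-Δ[] Q d)))
  where
  telescope : ∀ x → Δ[ suc Q ] h x ≡ Δ h x ℚ.+ Δ[ Q ] h (x ℤ.+ ℤ.1ℤ)
  telescope x = begin
    h (x ℤ.+ + suc Q) ℚ.- h x                             ≡⟨ cong (λ y → h y ℚ.- h x) (sym (ℤP.+-assoc x ℤ.1ℤ (+ Q))) ⟩
    h (x ℤ.+ ℤ.1ℤ ℤ.+ + Q) ℚ.- h x                        ≡⟨ split (h (x ℤ.+ ℤ.1ℤ ℤ.+ + Q)) (h (x ℤ.+ ℤ.1ℤ)) (h x) ⟩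
    Δ h x ℚ.+ (h (x ℤ.+ ℤ.1ℤ ℤ.+ + Q) ℚ.- h (x ℤ.+ ℤ.1ℤ))   ∎
    where
    open ≡-Reasoning
    split : ∀ a b c → a ℚ.- c ≡ (b ℚ.- c) ℚ.+ (a ℚ.- b)
    split = ℚS.solve 3 (λ a b c → a ℚS.:- c ℚS.:= (b ℚS.:- c) ℚS.:+ (a ℚS.:- b)) refl

DegreeBelow-∘* : ∀ {n h} Q → DegreeBelow n h → DegreeBelow n (λ k → h (+ Q * k))
DegreeBelow-∘* Q (identically-zero h≡0) = identically-zero (λ k → h≡0 (+ Q * k))
DegreeBelow-∘* {h = h} Q d@(Δ-degreeBelow _) =
  Δ-degreeBelow (DegreeBelow-cong (λ k → cong (λ y → h y ℚ.- h (+ Q * k)) (distrib k))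
                                  (DegreeBelow-∘* Q (DegreeBelow-Δ[] Q d)))
  where
  distrib : ∀ k → + Q * k ℤ.+ + Q ≡ + Q * (k ℤ.+ ℤ.1ℤ)
  distrib k = ℤS.solve 2 (λ q k → q ℤS.:* k ℤS.:+ q ℤS.:= q ℤS.:* (k ℤS.:+ ℤS.con ℤ.1ℤ)) refl (+ Q) k

DegreeBelow-*-affine : ∀ {n f} (g : ℤ → ℚ) b → (∀ k → g (k ℤ.+ ℤ.1ℤ) ≡ g k ℚ.+ b) →
                       DegreeBelow n f → DegreeBelow (suc n) (λ k → f k ℚ.* g k)
DegreeBelow-*-affine g b g-affine (identically-zero f≡0) =
  Δ-degreeBelow (identically-zero λ k →
    trans (cong₂ (λ u v → u ℚ.* g (k ℤ.+ ℤ.1ℤ) ℚ.- v ℚ.* g k) (f≡0 _) (f≡0 k))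
          (cong₂ ℚ._-_ (ℚP.*-zeroˡ (g (k ℤ.+ ℤ.1ℤ))) (ℚP.*-zeroˡ (g k))))
DegreeBelow-*-affine {f = f} g b g-affine d@(Δ-degreeBelow Δd) =
  Δ-degreeBelow (DegreeBelow-cong (λ k → sym (leibniz k))
    (DegreeBelow-+ (DegreeBelow-*-affine (λ k → g (k ℤ.+ ℤ.1ℤ)) b (λ k → g-affine (k ℤ.+ ℤ.1ℤ)) Δd)
                   (DegreeBelow-scale b d)))
  where
  product-rule : ∀ f₁ f₀ g₀ → f₁ ℚ.* (g₀ ℚ.+ b) ℚ.- f₀ ℚ.* g₀ ≡ (f₁ ℚ.- f₀) ℚ.* (g₀ ℚ.+ b) ℚ.+ b ℚ.* f₀
  product-rule f₁ f₀ g₀ = solve 4 (λ f₁ f₀ g₀ b → f₁ :* (g₀ :+ b) :- f₀ :* g₀ := (f₁ :- f₀) :* (g₀ :+ b) :+ b :* f₀) refl f₁ f₀ g₀ b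
    where open ℚS
  leibniz : ∀ k → Δ (λ k → f k ℚ.* g k) k ≡ Δ f k ℚ.* g (k ℤ.+ ℤ.1ℤ) ℚ.+ b ℚ.* f k
  leibniz k rewrite g-affine k = product-rule (f (k ℤ.+ ℤ.1ℤ)) (f k) (g k)

DegreeBelow-pow-affine : ∀ i (g : ℤ → ℚ) b → (∀ k → g (k ℤ.+ ℤ.1ℤ) ≡ g k ℚ.+ b) →
                         DegreeBelow (suc i) (λ k → pow (g k) i)
DegreeBelow-pow-affine zero    g b g-affine = Δ-degreeBelow (identically-zero (λ _ → refl))
DegreeBelow-pow-affine (suc i) g b g-affine =
  DegreeBelow-cong (λ k → ℚP.*-comm (pow (g k) i) (g k))
    (DegreeBelow-*-affine g b g-affine (DegreeBelow-pow-affine i g b g-affine))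

DegreeBelow-vanishesOnℕ : ∀ {n h} → DegreeBelow n h → (∀ j → h (+ j) ≡ 0ℚ) → ∀ k → h k ≡ 0ℚ
DegreeBelow-vanishesOnℕ (identically-zero h≡0) _ = h≡0
DegreeBelow-vanishesOnℕ {h = h} (Δ-degreeBelow d) h₊≡0 = vanishes
  where
  Δh≡0 : ∀ k → Δ h k ≡ 0ℚ
  Δh≡0 = DegreeBelow-vanishesOnℕ d (λ j → cong₂ ℚ._-_ (h₊≡0 (j ℕ.+ 1)) (h₊≡0 j))
  vanishes : ∀ k → h k ≡ 0ℚ
  vanishes (+ j)        = h₊≡0 j
  vanishes -[1+ zero ]  = trans (sym (x-y≡0⇒x≡y (Δh≡0 -[1+ zero ]))) (h₊≡0 0)
  vanishes -[1+ suc j ] = trans (sym (x-y≡0⇒x≡y (Δh≡0 -[1+ suc j ]))) (vanishes -[1+ j ])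

ι : ℤ → ℚ
ι x = x ℚ./ 1

ι≡mkℚ : ∀ x → ι x ≡ ℚ.mkℚ x 0 (Coprime.sym (Coprime.1-coprimeTo ∣ x ∣))
ι≡mkℚ x = ℚP.↥p/↧p≡p (ℚ.mkℚ x 0 (Coprime.sym (Coprime.1-coprimeTo ∣ x ∣)))

ι-+ : ∀ x y → ι (x ℤ.+ y) ≡ ι x ℚ.+ ι y
ι-+ x y = ℚP.toℚᵘ-injective (ℚᵘP.≃-trans toℚᵘ-ι-+ (ℚᵘP.≃-sym (ℚP.toℚᵘ-homo-+ (ι x) (ι y))))
  where
  open ℤS
  toℚᵘ-ι-+ : ℚ.toℚᵘ (ι (x ℤ.+ y)) ℚᵘ.≃ ℚ.toℚᵘ (ι x) ℚᵘ.+ ℚ.toℚᵘ (ι y)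
  toℚᵘ-ι-+ rewrite ι≡mkℚ (x ℤ.+ y) | ι≡mkℚ x | ι≡mkℚ y =
    ℚᵘ.*≡* (solve 2 (λ x y → (x :+ y) :* con ℤ.1ℤ := (x :* con ℤ.1ℤ :+ y :* con ℤ.1ℤ) :* con ℤ.1ℤ) refl x y)

record PolyOnResidues (n : ℕ) (F : ℤ → ℚ) : Set where
  constructor mkPolyOnResidues
  field
    period-1   : ℕ
    onResidues : ∀ a → DegreeBelow n (λ k → F (a ℤ.+ + suc period-1 * k))

PolyOnResidues-cong : ∀ {n F G} → (∀ s → F s ≡ G s) → PolyOnResidues n F → PolyOnResidues n G
PolyOnResidues-cong F≗G (mkPolyOnResidues N d) = mkPolyOnResidues N λ a → DegreeBelow-cong (λ k → F≗G _) (d a)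

PolyOnResidues-0 : ∀ n → PolyOnResidues n (λ _ → 0ℚ)
PolyOnResidues-0 n = mkPolyOnResidues 0 λ _ → DegreeBelow-0 n

DegreeBelow-refine : ∀ {n} (F : ℤ → ℚ) a M N → DegreeBelow n (λ k → F (a ℤ.+ M * k)) →
                     DegreeBelow n (λ k → F (a ℤ.+ M * + N * k))
DegreeBelow-refine F a M N d =
  DegreeBelow-cong (λ k → cong (λ x → F (a ℤ.+ x)) (sym (ℤP.*-assoc M (+ N) k)))
                   (DegreeBelow-∘* {h = λ x → F (a ℤ.+ M * x)} N d)

-- Both progressions are refined to the common period (M + 1)(N + 1).
PolyOnResidues-zipWith : ∀ {n F G} (_∙_ : ℚ → ℚ → ℚ) →
                         (∀ {h h′} → DegreeBelow n h → DegreeBelow n h′ → DegreeBelow n (λ k → h k ∙ h′ k)) →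
                         PolyOnResidues n F → PolyOnResidues n G → PolyOnResidues n (λ s → F s ∙ G s)
PolyOnResidues-zipWith {F = F} {G} _∙_ ∙-closed (mkPolyOnResidues M dF) (mkPolyOnResidues N dG) =
  mkPolyOnResidues (N ℕ.+ M ℕ.* suc N) λ a →
    ∙-closed (DegreeBelow-refine F a (+ suc M) (suc N) (dF a))
             (DegreeBelow-cong (λ k → cong (λ x → G (a ℤ.+ x * k)) (ℤP.*-comm (+ suc N) (+ suc M)))
                               (DegreeBelow-refine G a (+ suc N) (suc M) (dG a)))

PolyOnResidues-+ : ∀ {n F G} → PolyOnResidues n F → PolyOnResidues n G → PolyOnResidues n (λ s → F s ℚ.+ G s)
PolyOnResidues-+ = PolyOnResidues-zipWith ℚ._+_ DegreeBelow-+

PolyOnResidues-sub : ∀ {n F G} → PolyOnResidues n F → PolyOnResidues n G → PolyOnResidues n (λ s → F s ℚ.- G s)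
PolyOnResidues-sub = PolyOnResidues-zipWith ℚ._-_ DegreeBelow-sub

PolyOnResidues-shift : ∀ {n F} b → PolyOnResidues n F → PolyOnResidues n (λ x → F (b ℤ.+ x))
PolyOnResidues-shift {F = F} b (mkPolyOnResidues N d) =
  mkPolyOnResidues N λ a → DegreeBelow-cong (λ k → cong F (ℤP.+-assoc b a _)) (d (b ℤ.+ a))

PolyOnResidues-∘* : ∀ {n F} p → PolyOnResidues n F → PolyOnResidues n (λ t → F (+ p * t))
PolyOnResidues-∘* {F = F} p (mkPolyOnResidues N d) =
  mkPolyOnResidues N λ a → DegreeBelow-cong (λ k → cong F (distrib a k)) (DegreeBelow-∘* p (d (+ p * a)))
  where
  open ℤS
  distrib : ∀ a k → + p * a ℤ.+ + suc N * (+ p * k) ≡ + p * (a ℤ.+ + suc N * k)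
  distrib a k = solve 4 (λ p n a k → p :* a :+ n :* (p :* k) := p :* (a :+ n :* k)) refl (+ p) (+ suc N) a k

periodic-+* : ∀ {c : ℤ → ℚ} {N} → (∀ s → c (s ℤ.+ + N) ≡ c s) → ∀ a k → c (a ℤ.+ + N * k) ≡ c a
periodic-+* {c} {N} period a (+ j)     = forward a j
  where
  open ℤS
  forward : ∀ a j → c (a ℤ.+ + N * + j) ≡ c a
  forward a zero    = cong c (trans (cong (λ x → a ℤ.+ x) (ℤP.*-zeroʳ (+ N))) (ℤP.+-identityʳ a))
  forward a (suc j) = trans (cong c step) (trans (period _) (forward a j))
    where
    step : a ℤ.+ + N * + suc j ≡ (a ℤ.+ + N * + j) ℤ.+ + N
    step = solve 3 (λ a n j → a :+ n :* (con ℤ.1ℤ :+ j) := (a :+ n :* j) :+ n) refl a (+ N) (+ j)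
periodic-+* {c} {N} period a -[1+ j ] = begin
  c (a ℤ.+ + N * -[1+ j ])                          ≡⟨ periodic-+* period (a ℤ.+ + N * -[1+ j ]) (+ suc j) ⟨
  c (a ℤ.+ + N * -[1+ j ] ℤ.+ + N * + suc j)        ≡⟨ cong c cancel ⟩
  c a                                               ∎
  where
  open ≡-Reasoning
  open ℤS
  cancel : a ℤ.+ + N * -[1+ j ] ℤ.+ + N * + suc j ≡ a
  cancel = solve 3 (λ a n j → a :+ n :* (:- (con ℤ.1ℤ :+ j)) :+ n :* (con ℤ.1ℤ :+ j) := a) refl a (+ N) (+ j)

PolyOnResidues-monomial : ∀ {n c} → Periodic c → ∀ i → i < n → PolyOnResidues n (λ s → c s ℚ.* pow (ι s) i)
PolyOnResidues-monomial {c = c} (suc N , _ , period) i i<n = mkPolyOnResidues N λ a →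
  DegreeBelow-≤ i<n
    (DegreeBelow-cong (λ k → cong (ℚ._* pow (ι (a ℤ.+ + suc N * k)) i) (sym (periodic-+* period a k)))
      (DegreeBelow-scale (c a) (DegreeBelow-pow-affine i (λ k → ι (a ℤ.+ + suc N * k)) (ι (+ suc N)) (ι-step a))))
  where
  open ℤS
  ι-step : ∀ a k → ι (a ℤ.+ + suc N * (k ℤ.+ ℤ.1ℤ)) ≡ ι (a ℤ.+ + suc N * k) ℚ.+ ι (+ suc N)
  ι-step a k = trans (cong ι (solve 3 (λ a n k → a :+ n :* (k :+ con ℤ.1ℤ) := (a :+ n :* k) :+ n) refl a (+ suc N) k))
                     (ι-+ (a ℤ.+ + suc N * k) (+ suc N))

PolyOnResidues-sumFin : ∀ {n} k (T : Fin k → ℤ → ℚ) → (∀ i → PolyOnResidues n (T i)) →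
                        PolyOnResidues n (λ s → sumFin k (λ i → T i s))
PolyOnResidues-sumFin {n} zero    T _  = PolyOnResidues-0 n
PolyOnResidues-sumFin     (suc k) T pT =
  PolyOnResidues-+ (pT Fin.zero) (PolyOnResidues-sumFin k (λ i → T (Fin.suc i)) (λ i → pT (Fin.suc i)))

IsQuasiPoly⇒PolyOnResidues : ∀ {n F} → IsQuasiPoly n F → PolyOnResidues n F
IsQuasiPoly⇒PolyOnResidues {n} (c , periodic , F≡) =
  PolyOnResidues-cong (λ s → sym (F≡ s))
    (PolyOnResidues-sumFin n _ (λ i → PolyOnResidues-monomial (periodic i) (toℕ i) (FinP.toℕ<n i)))

∣i∣≤n⇒i+n∈ℕ : ∀ i {n} → ∣ i ∣ ≤ n → ∃ λ t → i ℤ.+ + n ≡ + t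
∣i∣≤n⇒i+n∈ℕ (+ i)     {n} _     = i ℕ.+ n , refl
∣i∣≤n⇒i+n∈ℕ -[1+ i ] {n} i<n = n ℕ.∸ suc i , ℤP.⊖-≥ i<n

-- The residue class of s is a progression through s that runs into ℕ, where H vanishes.
PolyOnResidues-vanishesOnℕ : ∀ {n H} → PolyOnResidues n H → (∀ j → H (+ j) ≡ 0ℚ) → ∀ s → H s ≡ 0ℚ
PolyOnResidues-vanishesOnℕ {H = H} (mkPolyOnResidues N d) H₊≡0 s = begin
  H s                                                 ≡⟨ cong H cancel ⟨
  H (s ℤ.+ + suc N * (ℤ.- + ∣ s ∣ ℤ.+ + ∣ s ∣))       ≡⟨ DegreeBelow-vanishesOnℕ (DegreeBelow-shift (+ ∣ s ∣) (d s)) h₊≡0 (ℤ.- + ∣ s ∣) ⟩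
  0ℚ                                                  ∎
  where
  open ≡-Reasoning
  cancel : s ℤ.+ + suc N * (ℤ.- + ∣ s ∣ ℤ.+ + ∣ s ∣) ≡ s
  cancel = ℤS.solve 3 (λ s n m → s ℤS.:+ n ℤS.:* (ℤS.:- m ℤS.:+ m) ℤS.:= s) refl s (+ suc N) (+ ∣ s ∣)
  h₊≡0 : ∀ j → H (s ℤ.+ + suc N * (+ j ℤ.+ + ∣ s ∣)) ≡ 0ℚ
  h₊≡0 j with ∣i∣≤n⇒i+n∈ℕ s (ℕP.≤-trans (ℕP.m≤n+m ∣ s ∣ j) (ℕP.m≤n*m (j ℕ.+ ∣ s ∣) (suc N)))
  ... | t , s+m≡t = trans (cong H (trans (cong (λ x → s ℤ.+ x) (sym (ℤP.pos-* (suc N) (j ℕ.+ ∣ s ∣)))) s+m≡t)) (H₊≡0 t)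

PolyOnResidues-unique : ∀ {n F G} → PolyOnResidues n F → PolyOnResidues n G →
                        (∀ j → F (+ j) ≡ G (+ j)) → ∀ s → F s ≡ G s
PolyOnResidues-unique pF pG F≡G s =
  x-y≡0⇒x≡y (PolyOnResidues-vanishesOnℕ (PolyOnResidues-sub pF pG) (λ j → x≡y⇒x-y≡0 (F≡G j)) s)

sum< : ℕ → (ℕ → ℕ) → ℕ
sum< zero    f = 0
sum< (suc n) f = sum< n f ℕ.+ f n

sum<-cong : ∀ n {f g} → (∀ j → j < n → f j ≡ g j) → sum< n f ≡ sum< n g
sum<-cong zero    f≗g = refl
sum<-cong (suc n) f≗g = cong₂ ℕ._+_ (sum<-cong n (λ j j<n → f≗g j (ℕP.m<n⇒m<1+n j<n))) (f≗g n ℕP.≤-refl)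

sum<-0 : ∀ n {f} → (∀ j → j < n → f j ≡ 0) → sum< n f ≡ 0
sum<-0 zero    f≡0 = refl
sum<-0 (suc n) f≡0 =
  cong₂ ℕ._+_ (sum<-0 n (λ j j<n → f≡0 j (ℕP.m<n⇒m<1+n j<n))) (f≡0 n ℕP.≤-refl)

sum<-head : ∀ {n} f → 0 < n → (∀ j → 0 < j → j < n → f j ≡ 0) → sum< n f ≡ f 0
sum<-head {suc zero}    f _ _   = refl
sum<-head {suc (suc n)} f _ f≡0 =
  trans (cong₂ ℕ._+_ (sum<-head f (s≤s z≤n) (λ j 0<j j<n → f≡0 j 0<j (ℕP.m<n⇒m<1+n j<n)))
                     (f≡0 (suc n) (s≤s z≤n) ℕP.≤-refl))
        (ℕP.+-identityʳ (f 0))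

sum<-+ : ∀ m n f → sum< (m ℕ.+ n) f ≡ sum< m f ℕ.+ sum< n (λ j → f (m ℕ.+ j))
sum<-+ m zero    f = trans (cong (λ k → sum< k f) (ℕP.+-identityʳ m)) (sym (ℕP.+-identityʳ _))
sum<-+ m (suc n) f = begin
  sum< (m ℕ.+ suc n) f                                              ≡⟨ cong (λ k → sum< k f) (ℕP.+-suc m n) ⟩
  sum< (m ℕ.+ n) f ℕ.+ f (m ℕ.+ n)                                  ≡⟨ cong (ℕ._+ f (m ℕ.+ n)) (sum<-+ m n f) ⟩
  (sum< m f ℕ.+ sum< n (λ j → f (m ℕ.+ j))) ℕ.+ f (m ℕ.+ n)         ≡⟨ ℕP.+-assoc (sum< m f) _ _ ⟩
  sum< m f ℕ.+ sum< (suc n) (λ j → f (m ℕ.+ j))                     ∎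
  where open ≡-Reasoning

sum<-* : ∀ p q f → sum< (p ℕ.* q) f ≡ sum< q (λ i → sum< p (λ r → f (p ℕ.* i ℕ.+ r)))
sum<-* p zero    f = cong (λ k → sum< k f) (ℕP.*-zeroʳ p)
sum<-* p (suc q) f = begin
  sum< (p ℕ.* suc q) f                                              ≡⟨ cong (λ k → sum< k f) (trans (ℕP.*-suc p q) (ℕP.+-comm p (p ℕ.* q))) ⟩
  sum< (p ℕ.* q ℕ.+ p) f                                            ≡⟨ sum<-+ (p ℕ.* q) p f ⟩
  sum< (p ℕ.* q) f ℕ.+ sum< p (λ r → f (p ℕ.* q ℕ.+ r))             ≡⟨ cong (ℕ._+ sum< p (λ r → f (p ℕ.* q ℕ.+ r))) (sum<-* p q f) ⟩
  sum< (suc q) (λ i → sum< p (λ r → f (p ℕ.* i ℕ.+ r)))            ∎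
  where open ≡-Reasoning

convSum≡sum< : ∀ (a b : ℕ → ℕ) s → convSum a b s ≡ sum< (suc s) (λ j → a j ℕ.* b (s ℕ.∸ j))
convSum≡sum< a b zero    = refl
convSum≡sum< a b (suc s) =
  cong₂ ℕ._+_ (trans (convSum≡sum< a (λ k → b (suc k)) s)
                     (sum<-cong (suc s) (λ j j≤s → cong (λ k → a j ℕ.* b k) (sym (ℕP.+-∸-assoc 1 (ℕP.≤-pred j≤s))))))
              (cong (λ k → a (suc s) ℕ.* b k) (sym (ℕP.n∸n≡0 s)))

W-∷ : ∀ {m} t e (d : Vec ℕ m) → W t (e ∷ d) ≡ convSum (geomCoeff e) (λ k → W k d) t
W-∷ zero    e d = refl
W-∷ (suc t) e d = refl

W-[]-nonZero : ∀ s .{{_ : NonZero s}} → W s [] ≡ 0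
W-[]-nonZero (suc s) = refl

IsDilation : ℕ → (ℕ → ℕ) → (ℕ → ℕ) → Set
IsDilation p A a = (∀ q → A (p ℕ.* q) ≡ a q) × (∀ q r → 0 < r → r < p → A (p ℕ.* q ℕ.+ r) ≡ 0)

module _ (p : ℕ) .{{_ : NonZero p}} where

  IsDilation-cong : ∀ {A A′ a a′} → (∀ s → A s ≡ A′ s) → (∀ t → a t ≡ a′ t) →
                    IsDilation p A a → IsDilation p A′ a′
  IsDilation-cong A≗A′ a≗a′ (A≡a , A≡0) =
    (λ q → trans (sym (A≗A′ _)) (trans (A≡a q) (a≗a′ q))) , (λ q r 0<r r<p → trans (sym (A≗A′ _)) (A≡0 q r 0<r r<p))

  -- Only the terms j = p i of the convolution survive.
  convSum-dilationˡ : ∀ {A a} B → IsDilation p A a → ∀ q r → r < p →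
                      convSum A B (p ℕ.* q ℕ.+ r) ≡ sum< (suc q) (λ i → a i ℕ.* B (p ℕ.* (q ℕ.∸ i) ℕ.+ r))
  convSum-dilationˡ {A} {a} B (A≡a , A≡0) q r r<p = begin
    convSum A B s                                                   ≡⟨ convSum≡sum< A B s ⟩
    sum< (suc s) f                                                  ≡⟨ cong (λ k → sum< k f) (sym (ℕP.+-suc (p ℕ.* q) r)) ⟩
    sum< (p ℕ.* q ℕ.+ suc r) f                                      ≡⟨ sum<-+ (p ℕ.* q) (suc r) f ⟩
    sum< (p ℕ.* q) f ℕ.+ sum< (suc r) (λ j → f (p ℕ.* q ℕ.+ j))     ≡⟨ cong₂ ℕ._+_ (trans (sum<-* p q f) (sum<-cong q (λ i _ → block i))) last-block ⟩
    sum< q (λ i → f (p ℕ.* i ℕ.+ 0)) ℕ.+ f (p ℕ.* q ℕ.+ 0)          ≡⟨ cong₂ ℕ._+_ (sum<-cong q (λ i i<q → term i (ℕP.<⇒≤ i<q))) (term q ℕP.≤-refl) ⟩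
    sum< (suc q) (λ i → a i ℕ.* B (p ℕ.* (q ℕ.∸ i) ℕ.+ r))          ∎
    where
    open ≡-Reasoning
    s = p ℕ.* q ℕ.+ r
    f : ℕ → ℕ
    f j = A j ℕ.* B (s ℕ.∸ j)
    off-multiple : ∀ i j → 0 < j → j < p → f (p ℕ.* i ℕ.+ j) ≡ 0
    off-multiple i j 0<j j<p = cong (ℕ._* B (s ℕ.∸ (p ℕ.* i ℕ.+ j))) (A≡0 i j 0<j j<p)
    block : ∀ i → sum< p (λ j → f (p ℕ.* i ℕ.+ j)) ≡ f (p ℕ.* i ℕ.+ 0)
    block i = sum<-head _ (ℕ.>-nonZero⁻¹ p) (off-multiple i)
    last-block : sum< (suc r) (λ j → f (p ℕ.* q ℕ.+ j)) ≡ f (p ℕ.* q ℕ.+ 0)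
    last-block = sum<-head _ (s≤s z≤n) (λ j 0<j j≤r → off-multiple q j 0<j (ℕP.<-≤-trans j≤r r<p))
    term : ∀ i → i ≤ q → f (p ℕ.* i ℕ.+ 0) ≡ a i ℕ.* B (p ℕ.* (q ℕ.∸ i) ℕ.+ r)
    term i i≤q rewrite ℕP.+-identityʳ (p ℕ.* i) =
      cong₂ ℕ._*_ (A≡a i) (cong B (trans (ℕP.+-∸-comm r (ℕP.*-monoʳ-≤ p i≤q)) (cong (ℕ._+ r) (sym (ℕP.*-distribˡ-∸ p q i)))))

  convSum-isDilation : ∀ {A B a b} → IsDilation p A a → IsDilation p B b → IsDilation p (convSum A B) (convSum a b)
  convSum-isDilation {A} {B} {a} {b} A-dil (B≡b , B≡0) = on-multiples , off-multiples
    where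
    on-multiples : ∀ q → convSum A B (p ℕ.* q) ≡ convSum a b q
    on-multiples q = begin
      convSum A B (p ℕ.* q)                                   ≡⟨ cong (convSum A B) (sym (ℕP.+-identityʳ (p ℕ.* q))) ⟩
      convSum A B (p ℕ.* q ℕ.+ 0)                             ≡⟨ convSum-dilationˡ B A-dil q 0 (ℕ.>-nonZero⁻¹ p) ⟩
      sum< (suc q) (λ i → a i ℕ.* B (p ℕ.* (q ℕ.∸ i) ℕ.+ 0))  ≡⟨ sum<-cong (suc q) (λ i _ → cong (a i ℕ.*_) (trans (cong B (ℕP.+-identityʳ _)) (B≡b (q ℕ.∸ i)))) ⟩
      sum< (suc q) (λ i → a i ℕ.* b (q ℕ.∸ i))                ≡⟨ convSum≡sum< a b q ⟨
      convSum a b q                                           ∎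
      where open ≡-Reasoning
    off-multiples : ∀ q r → 0 < r → r < p → convSum A B (p ℕ.* q ℕ.+ r) ≡ 0
    off-multiples q r 0<r r<p =
      trans (convSum-dilationˡ B A-dil q r r<p)
            (sum<-0 (suc q) (λ i _ → trans (cong (a i ℕ.*_) (B≡0 (q ℕ.∸ i) r 0<r r<p)) (ℕP.*-zeroʳ (a i))))

  geomCoeff-isDilation : ∀ e → IsDilation p (geomCoeff (p ℕ.* e)) (geomCoeff e)
  geomCoeff-isDilation e = on-multiples , off-multiples
    where
    on-multiples : ∀ q → geomCoeff (p ℕ.* e) (p ℕ.* q) ≡ geomCoeff e q
    on-multiples q with p ℕ.* e ℕD.∣? p ℕ.* q | e ℕD.∣? q
    ... | yes _        | yes _   = refl
    ... | no _         | no _    = refl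
    ... | yes pe∣pq    | no e∤q  = contradiction (ℕD.*-cancelˡ-∣ p pe∣pq) e∤q
    ... | no pe∤pq     | yes e∣q = contradiction (ℕD.*-monoʳ-∣ p e∣q) pe∤pq
    off-multiples : ∀ q r → 0 < r → r < p → geomCoeff (p ℕ.* e) (p ℕ.* q ℕ.+ r) ≡ 0
    off-multiples q r 0<r r<p with p ℕ.* e ℕD.∣? p ℕ.* q ℕ.+ r
    ... | no _        = refl
    ... | yes pe∣pq+r = contradiction (ℕD.∣⇒≤ {{ℕ.>-nonZero 0<r}} p∣r) (ℕP.<⇒≱ r<p)
      where
      p∣r : p ℕD.∣ r
      p∣r = ℕD.∣m+n∣m⇒∣n (ℕD.∣-trans (ℕD.m∣m*n e) pe∣pq+r) (ℕD.m∣m*n q)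

  W-[]-isDilation : IsDilation p (λ s → W s []) (λ t → W t [])
  W-[]-isDilation = on-multiples , off-multiples
    where
    on-multiples : ∀ q → W (p ℕ.* q) [] ≡ W q []
    on-multiples zero    rewrite ℕP.*-zeroʳ p = refl
    on-multiples (suc q) = W-[]-nonZero (p ℕ.* suc q) {{ℕP.m*n≢0 p (suc q)}}
    off-multiples : ∀ q r → 0 < r → r < p → W (p ℕ.* q ℕ.+ r) [] ≡ 0
    off-multiples q (suc r) _ _ rewrite ℕP.+-suc (p ℕ.* q) r = refl

  W-scale-isDilation : ∀ {m} (d : Vec ℕ m) → IsDilation p (λ s → W s (scale p d)) (λ t → W t d)
  W-scale-isDilation []      = W-[]-isDilation
  W-scale-isDilation (e ∷ d) =
    IsDilation-cong (λ s → sym (W-∷ s (p ℕ.* e) (scale p d))) (λ t → sym (W-∷ t e d))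
      (convSum-isDilation (geomCoeff-isDilation e) (W-scale-isDilation d))

indivisible⇒residue : ∀ s p .{{_ : NonZero p}} → ¬ (+ p ∣ s) →
                      ∃₂ λ r q → 0 < r × r < p × s ≡ + r ℤ.+ + p * q
indivisible⇒residue s p p∤s = split (s ℤD.%ℕ p) refl
  where
  q = s ℤD./ℕ p
  s≡r+pq : ∀ {r} → s ℤD.%ℕ p ≡ r → s ≡ + r ℤ.+ + p * q
  s≡r+pq refl = trans (ℤD.a≡a%ℕn+[a/ℕn]*n s p) (cong (λ x → + (s ℤD.%ℕ p) ℤ.+ x) (ℤP.*-comm q (+ p)))
  split : ∀ r → s ℤD.%ℕ p ≡ r → ∃₂ λ r q → 0 < r × r < p × s ≡ + r ℤ.+ + p * q
  split zero    s%p≡0 = contradiction p∣s p∤s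
    where
    p∣s : + p ∣ s
    p∣s rewrite trans (s≡r+pq s%p≡0) (ℤP.+-identityˡ (+ p * q)) | ℤP.abs-* (+ p) q = ℕD.m∣m*n ∣ q ∣
  split (suc r) s%p≡r = suc r , q , s≤s z≤n , subst (_< p) s%p≡r (ℤD.n%ℕd<d s p) , s≡r+pq s%p≡r

lemma4p2 : (m : ℕ) → m ≥ 1 → (d : Vec ℕ m) → (∀ i → NonZero (lookup d i)) →
             (p : ℕ) → NonZero p →
             (f g : ℤ → ℚ) → IsWtilde (scale p d) f → IsWtilde d g →
             (∀ (t : ℤ) → f (+ p * t) ≡ g t) × (∀ (s : ℤ) → ¬ (+ p ∣ s) → f s ≡ 0ℚ)
lemma4p2 m _ d _ p p≢0 f g (f-qp , f≡W) (g-qp , g≡W) = on-multiples , off-multiples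
  where
  open ≡-Reasoning
  instance _ = p≢0
  f-poly : PolyOnResidues m f
  f-poly = IsQuasiPoly⇒PolyOnResidues f-qp
  W-dilation : IsDilation p (λ s → W s (scale p d)) (λ t → W t d)
  W-dilation = W-scale-isDilation p d
  on-multiples : ∀ t → f (+ p * t) ≡ g t
  on-multiples = PolyOnResidues-unique (PolyOnResidues-∘* p f-poly) (IsQuasiPoly⇒PolyOnResidues g-qp) λ j → begin
    f (+ p * + j)                  ≡⟨ cong f (ℤP.pos-* p j) ⟨
    f (+ (p ℕ.* j))                ≡⟨ f≡W (p ℕ.* j) ⟩
    ι (+ W (p ℕ.* j) (scale p d))  ≡⟨ cong (λ w → ι (+ w)) (proj₁ W-dilation j) ⟩
    ι (+ W j d)                    ≡⟨ g≡W j ⟨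
    g (+ j)                        ∎
  off-multiples : ∀ s → ¬ (+ p ∣ s) → f s ≡ 0ℚ
  off-multiples s p∤s with indivisible⇒residue s p p∤s
  ... | r , q , 0<r , r<p , s≡r+pq =
    trans (cong f s≡r+pq) (PolyOnResidues-vanishesOnℕ (PolyOnResidues-∘* p (PolyOnResidues-shift (+ r) f-poly)) f-off q)
    where
    f-off : ∀ j → f (+ r ℤ.+ + p * + j) ≡ 0ℚ
    f-off j = begin
      f (+ r ℤ.+ + p * + j)              ≡⟨ cong (λ x → f (+ r ℤ.+ x)) (ℤP.pos-* p j) ⟨
      f (+ (r ℕ.+ p ℕ.* j))              ≡⟨ f≡W (r ℕ.+ p ℕ.* j) ⟩
      ι (+ W (r ℕ.+ p ℕ.* j) (scale p d)) ≡⟨ cong (λ n → ι (+ W n (scale p d))) (ℕP.+-comm r (p ℕ.* j)) ⟩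
      ι (+ W (p ℕ.* j ℕ.+ r) (scale p d)) ≡⟨ cong (λ w → ι (+ w)) (proj₂ W-dilation j r 0<r r<p) ⟩
      0ℚ                                 ∎
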